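{- For every graph $G$, the strong product $G\boxtimes K_2$ satisfies ${\rm mdim}(G\boxtimes K_2)=n(G\boxtimes K_2)$.
   Context: All graphs are finite, simple and connected; $n(G)=|V(G)|$. The strong product $G\boxtimes H$ has vertex set $V(G)\times V(H)$, with $(g_1,h_1)$ adjacent to $(g_2,h_2)$ if either $h_1=h_2$ and $g_1g_2\in E(G)$, or $g_1=g_2$ and $h_1h_2\in E(H)$, or $g_1g_2\in E(G)$ and $h_1h_2\in E(H)$. For vertices $u,v$, $d_G(u,v)$ is the shortest-path distance; for an edge $x=ww'$ and a vertex $v$, $d_G(x,v)=\min\{d_G(w,v),d_G(w',v)\}$. A vertex $v$ resolves two elements $x,y\in V(G)\cup E(G)$ if $d_G(x,v)\ne d_G(y,v)$. A set $W\subseteq V(G)$ is a mixed resolving set of $G$ if every two distinct elements of $V(G)\cup E(G)$ are resolved by some vertex of $W$. The mixed metric dimension ${\rm mdim}(G)$ is the minimum cardinality of a mixed resolving set of $G$. -}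

module Defs where

open import Data.Nat using (ℕ; zero; suc; _≤_; _⊓_; _*_)
open import Data.Fin using (Fin; _<_; remQuot)
open import Data.Fin.Subset using (Subset; _∈_; ∣_∣)
open import Data.Product using (Σ; ∃; _×_; _,_; proj₁; proj₂)
open import Data.Sum using (_⊎_)
open import Data.Unit using (⊤)
open import Relation.Binary.PropositionalEquality using (_≡_; _≢_)
open import Relation.Nullary using (¬_)

record Graph : Set₁ where
  field
    n   : ℕ
    Adj : Fin n → Fin n → Set
open Graph public

record IsSimple (G : Graph) : Set where
  field
    sym     : ∀ {u v} → Adj G u v → Adj G v u
    irrefl  : ∀ {u} → ¬ Adj G u u

data Walk (G : Graph) : Fin (n G) → Fin (n G) → ℕ → Set where
  here : ∀ {u} → Walk G u u zero
  step : ∀ {u v w k} → Adj G u v → Walk G v w k → Walk G u w (suc k)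

Connected : Graph → Set
Connected G = ∀ u v → ∃ λ k → Walk G u v k

Dist : (G : Graph) → Fin (n G) → Fin (n G) → ℕ → Set
Dist G u v k = Walk G u v k × (∀ m → Walk G u v m → k ≤ m)

-- elements of V(G) ∪ E(G); an edge {i,j} is represented as edg i j with i < j
data Elem (G : Graph) : Set where
  vtx : Fin (n G) → Elem G
  edg : Fin (n G) → Fin (n G) → Elem G

ValidElem : (G : Graph) → Elem G → Set
ValidElem G (vtx i)   = ⊤
ValidElem G (edg i j) = (i < j) × Adj G i j

Distinct : (G : Graph) → Elem G → Elem G → Set
Distinct G (vtx i)   (vtx j)   = i ≢ j
Distinct G (vtx i)   (edg _ _) = ⊤
Distinct G (edg _ _) (vtx _)   = ⊤
Distinct G (edg i j) (edg k l) = ¬ ((i ≡ k) × (j ≡ l))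

DistE : (G : Graph) → Elem G → Fin (n G) → ℕ → Set
DistE G (vtx u)   v k = Dist G u v k
DistE G (edg w w') v k =
  Σ ℕ λ a → Σ ℕ λ b → Dist G w v a × Dist G w' v b × (k ≡ a ⊓ b)

Resolves : (G : Graph) → Fin (n G) → Elem G → Elem G → Set
Resolves G v x y = ∀ a b → DistE G x v a → DistE G y v b → a ≢ b

IsMixedResolving : (G : Graph) → Subset (n G) → Set
IsMixedResolving G W =
  ∀ x y → ValidElem G x → ValidElem G y → Distinct G x y →
  ∃ λ v → (v ∈ W) × Resolves G v x y

MDim : (G : Graph) → ℕ → Set
MDim G k =
  (∃ λ W → IsMixedResolving G W × (∣ W ∣ ≡ k)) ×
  (∀ W → IsMixedResolving G W → k ≤ ∣ W ∣)

-- strong product; vertex (g,h) of G ⊠ H is encoded in Fin (n G * n H)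
_⊠_ : Graph → Graph → Graph
G ⊠ H = record
  { n   = n G * n H
  ; Adj = λ p q →
      let g₁ = proj₁ (remQuot {n G} (n H) p) ; h₁ = proj₂ (remQuot {n G} (n H) p)
          g₂ = proj₁ (remQuot {n G} (n H) q) ; h₂ = proj₂ (remQuot {n G} (n H) q)
      in ((h₁ ≡ h₂) × Adj G g₁ g₂)
       ⊎ ((g₁ ≡ g₂) × Adj H h₁ h₂)
       ⊎ (Adj G g₁ g₂ × Adj H h₁ h₂)
  }

K₂ : Graph
K₂ = record { n = 2 ; Adj = λ u v → u ≢ v }

{-# OPTIONS --safe #-}
-- Call u a maximal neighbour of v if u is adjacent to v and N[v] ⊆ N[u].
-- A walk from v to any w ≠ v can then be made to start at u instead without
-- getting longer, so d(u,w) ≤ d(v,w) and the edge vu is at distance d(u,w)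
-- from w: no vertex other than v distinguishes u from vu, and v lies in every
-- mixed resolving set. In G ⊠ K₂ the vertex (g,h′) is a maximal neighbour of
-- (g,h), so every mixed resolving set is the whole vertex set, which does
-- resolve: distance 0 detects whether a vertex lies on an element.
module Submission where

open import Defs
open import Data.Nat as ℕ using (ℕ; zero; suc; _≤_; _+_)
open import Data.Nat.Properties using (≤-refl; ≤-trans; n≤1+n; n≤0⇒n≡0; m≥n⇒m⊓n≡n; ⊓-comm; ⊓-zeroʳ; _≤?_; ≰⇒>)
open import Data.Nat.Induction using (<-rec)
open import Data.Fin using (Fin; zero; suc; _<_; combine; remQuot; _≟_)
open import Data.Fin.Properties using (<-cmp; <-irrefl; <-asym; remQuot-combine; combine-remQuot)
open import Data.Fin.Subset using (_∈_; ∣_∣; ⊤)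
open import Data.Fin.Subset.Properties using (_∈?_; ∈⊤; ∣⊤∣≡n; p⊆q⇒∣p∣≤∣q∣)
open import Data.Product using (∃; ∃-syntax; _×_; _,_; proj₂; uncurry; map₂)
open import Data.Sum using (_⊎_; inj₁; inj₂; swap)
open import Data.Unit using (tt)
open import Data.Empty using (⊥-elim)
open import Function using (_∘_)
open import Relation.Binary using (tri<; tri≈; tri>)
open import Relation.Binary.PropositionalEquality using (_≡_; _≢_; refl; sym; trans; cong; subst; subst₂)
open import Relation.Nullary using (¬_; Dec; yes; no)
open import Relation.Nullary.Decidable using (decidable-stable; _⊎-dec_)

-- Adjacency is not decidable, so distances exist only up to double negation;
-- that suffices here because Resolves is a negative statement.
¬¬-least : {P : ℕ → Set} {k : ℕ} → P k → ¬ ¬ (∃[ m ] P m × (∀ j → P j → m ≤ j))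
¬¬-least {P} {k} pk no-least = <-rec (λ k → ¬ P k) absent k pk
  where
  absent : ∀ k → (∀ {j} → j ℕ.< k → ¬ P j) → ¬ P k
  absent k below pk = no-least (k , pk , least)
    where
    least : ∀ j → P j → k ≤ j
    least j pj with k ≤? j
    ... | yes k≤j = k≤j
    ... | no k≰j = ⊥-elim (below (≰⇒> k≰j) pj)

module _ {H : Graph} where

  Walk-zero⇒≡ : ∀ {u v} → Walk H u v 0 → u ≡ v
  Walk-zero⇒≡ here = refl

  _++ʷ_ : ∀ {u v w k m} → Walk H u v k → Walk H v w m → Walk H u w (k + m)
  here       ++ʷ walk′ = walk′
  step a walk ++ʷ walk′ = step a (walk ++ʷ walk′)

  ¬¬-Dist : ∀ {u v k} → Walk H u v k → ¬ ¬ ∃ (Dist H u v)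
  ¬¬-Dist = ¬¬-least

  Dist-self : ∀ {v a} → Dist H v v a → a ≡ 0
  Dist-self (_ , least) = n≤0⇒n≡0 (least 0 here)

  Dist-≢⇒≢0 : ∀ {u v a} → u ≢ v → Dist H u v a → a ≢ 0
  Dist-≢⇒≢0 u≢v (walk , _) refl = u≢v (Walk-zero⇒≡ walk)

  DistE-edg-swap : ∀ {i j w k} → DistE H (edg i j) w k → DistE H (edg j i) w k
  DistE-edg-swap (a , b , dᵢ , dⱼ , refl) = b , a , dⱼ , dᵢ , ⊓-comm a b

  Resolves-edg-swap : ∀ {w x i j} → Resolves H w x (edg i j) → Resolves H w x (edg j i)
  Resolves-edg-swap resolves a b dx dy = resolves a b dx (DistE-edg-swap dy)

  _∈ᴱ_ : Fin (n H) → Elem H → Set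
  v ∈ᴱ vtx i   = v ≡ i
  v ∈ᴱ edg i j = v ≡ i ⊎ v ≡ j

  _∈ᴱ?_ : ∀ v x → Dec (v ∈ᴱ x)
  v ∈ᴱ? vtx i   = v ≟ i
  v ∈ᴱ? edg i j = (v ≟ i) ⊎-dec (v ≟ j)

  DistE-∈ᴱ : ∀ {x v a} → v ∈ᴱ x → DistE H x v a → a ≡ 0
  DistE-∈ᴱ {vtx _}   refl        d                     = Dist-self d
  DistE-∈ᴱ {edg _ _} (inj₁ refl) (_ , _ , d , _ , refl) rewrite Dist-self d = refl
  DistE-∈ᴱ {edg _ _} (inj₂ refl) (a , _ , _ , d , refl) rewrite Dist-self d = ⊓-zeroʳ a

  DistE-∉ᴱ : ∀ {x v a} → ¬ v ∈ᴱ x → DistE H x v a → a ≢ 0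
  DistE-∉ᴱ {vtx _}   v∉x d                               = Dist-≢⇒≢0 (v∉x ∘ sym) d
  DistE-∉ᴱ {edg _ _} v∉x (zero  , _     , d , _ , _)    _  = Dist-≢⇒≢0 (v∉x ∘ inj₁ ∘ sym) d refl
  DistE-∉ᴱ {edg _ _} v∉x (suc _ , zero  , _ , d , _)    _  = Dist-≢⇒≢0 (v∉x ∘ inj₂ ∘ sym) d refl
  DistE-∉ᴱ {edg _ _} v∉x (suc _ , suc _ , _ , _ , refl) ()

  Separates : Fin (n H) → Elem H → Elem H → Set
  Separates v x y = (v ∈ᴱ x × ¬ v ∈ᴱ y) ⊎ (v ∈ᴱ y × ¬ v ∈ᴱ x)

  Separates⇒Resolves : ∀ {v x y} → Separates v x y → Resolves H v x y
  Separates⇒Resolves (inj₁ (v∈x , v∉y)) a b dx dy a≡b = DistE-∉ᴱ v∉y dy (trans (sym a≡b) (DistE-∈ᴱ v∈x dx))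
  Separates⇒Resolves (inj₂ (v∈y , v∉x)) a b dx dy a≡b = DistE-∉ᴱ v∉x dx (trans a≡b (DistE-∈ᴱ v∈y dy))

  endpoints∈ᴱ⇒≡edg : ∀ {i j y} → i < j → ValidElem H y → i ∈ᴱ y → j ∈ᴱ y → y ≡ edg i j
  endpoints∈ᴱ⇒≡edg {y = vtx _}   i<j _         refl        refl        = ⊥-elim (<-irrefl refl i<j)
  endpoints∈ᴱ⇒≡edg {y = edg _ _} _   _         (inj₁ refl) (inj₂ refl) = refl
  endpoints∈ᴱ⇒≡edg {y = edg _ _} i<j _         (inj₁ refl) (inj₁ refl) = ⊥-elim (<-irrefl refl i<j)
  endpoints∈ᴱ⇒≡edg {y = edg _ _} i<j _         (inj₂ refl) (inj₂ refl) = ⊥-elim (<-irrefl refl i<j)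
  endpoints∈ᴱ⇒≡edg {y = edg _ _} i<j (k<l , _) (inj₂ refl) (inj₁ refl) = ⊥-elim (<-asym i<j k<l)

  edg-separated : ∀ {i j y} → i < j → ValidElem H y → Distinct H (edg i j) y → ∃[ v ] Separates v (edg i j) y
  edg-separated {i} {j} {y} i<j valid distinct with i ∈ᴱ? y | j ∈ᴱ? y
  ... | no i∉y | _      = i , inj₁ (inj₁ refl , i∉y)
  ... | yes _  | no j∉y = j , inj₁ (inj₂ refl , j∉y)
  ... | yes i∈y | yes j∈y with endpoints∈ᴱ⇒≡edg i<j valid i∈y j∈y
  ...   | refl = ⊥-elim (distinct (refl , refl))

  separated : ∀ {x y} → ValidElem H x → ValidElem H y → Distinct H x y → ∃[ v ] Separates v x y
  separated {vtx i}   {vtx _}   _         _         i≢j      = i , inj₁ (refl , i≢j)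
  separated {vtx _}   {edg _ _} _         (k<l , _) _        = map₂ swap (edg-separated k<l tt tt)
  separated {edg _ _}           (i<j , _) valid     distinct = edg-separated i<j valid distinct

  ⊤-isMixedResolving : IsMixedResolving H ⊤
  ⊤-isMixedResolving x y valid-x valid-y distinct =
    let v , v-separates = separated valid-x valid-y distinct
    in  v , ∈⊤ , Separates⇒Resolves v-separates

record MaximalNeighbour (H : Graph) (v u : Fin (n H)) : Set where
  field
    adjacent  : Adj H v u
    dominates : ∀ {z} → Adj H v z → z ≡ u ⊎ Adj H u z

module _ {H : Graph} (simple : IsSimple H) {v u : Fin (n H)} (maximal : MaximalNeighbour H v u) where
  open IsSimple simple using (irrefl) renaming (sym to Adj-sym)
  open MaximalNeighbour maximal

  reroute : ∀ {w k} → w ≢ v → Walk H v w k → ∃[ m ] m ≤ k × Walk H u w m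
  reroute w≢v here = ⊥-elim (w≢v refl)
  reroute {k = suc k} _ (step v∼z walk) with dominates v∼z
  ... | inj₁ refl = k , n≤1+n k , walk
  ... | inj₂ u∼z  = suc k , ≤-refl , step u∼z walk

  Dist-maximalNeighbour-≤ : ∀ {w a b} → w ≢ v → Dist H v w a → Dist H u w b → b ≤ a
  Dist-maximalNeighbour-≤ w≢v (walk , _) (_ , least) =
    let m , m≤a , walk′ = reroute w≢v walk in ≤-trans (least m walk′) m≤a

  ¬Resolves-maximalNeighbour : ∀ {w k} → w ≢ v → Walk H v w k → ¬ Resolves H w (vtx u) (edg v u)
  ¬Resolves-maximalNeighbour w≢v walk resolves =
    ¬¬-Dist walk λ (a , v-w) →
    ¬¬-Dist (proj₂ (proj₂ (reroute w≢v walk))) λ (b , u-w) →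
    resolves b b u-w (a , b , v-w , u-w , sym (m≥n⇒m⊓n≡n (Dist-maximalNeighbour-≤ w≢v v-w u-w))) refl

  maximalNeighbour-∈ : Connected H → ∀ {W} → IsMixedResolving H W → v ∈ W
  maximalNeighbour-∈ connected {W} resolving = decidable-stable (v ∈? W) ¬v∉W
    where
    unresolved : ¬ v ∈ W → ∀ {w} → w ∈ W → ¬ Resolves H w (vtx u) (edg v u)
    unresolved v∉W w∈W = ¬Resolves-maximalNeighbour (λ { refl → v∉W w∈W }) (proj₂ (connected v _))

    ¬v∉W : ¬ ¬ v ∈ W
    ¬v∉W v∉W with <-cmp v u
    ... | tri< v<u _ _ =
      let _ , w∈W , resolves = resolving (vtx u) (edg v u) tt (v<u , adjacent) tt
      in  unresolved v∉W w∈W resolves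
    ... | tri≈ _ refl _ = irrefl adjacent
    ... | tri> _ _ u<v =
      let _ , w∈W , resolves = resolving (vtx u) (edg u v) tt (u<v , Adj-sym adjacent) tt
      in  unresolved v∉W w∈W (Resolves-edg-swap {x = vtx u} resolves)

maximalNeighbours⇒MDim-n : (H : Graph) → IsSimple H → Connected H →
                           (∀ v → ∃ (MaximalNeighbour H v)) → MDim H (n H)
maximalNeighbours⇒MDim-n H simple connected maximal =
  (⊤ , ⊤-isMixedResolving {H} , ∣⊤∣≡n (n H)) ,
  λ W resolving → subst (_≤ ∣ W ∣) (∣⊤∣≡n (n H))
    (p⊆q⇒∣p∣≤∣q∣ {p = ⊤} λ {v} _ → maximalNeighbour-∈ simple (proj₂ (maximal v)) connected resolving)

module _ {G H : Graph} where

  coords : Fin (n (G ⊠ H)) → Fin (n G) × Fin (n H)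
  coords = remQuot (n H)

  ⟨_,_⟩ : Fin (n G) → Fin (n H) → Fin (n (G ⊠ H))
  ⟨_,_⟩ = combine

  coords-⟨⟩ : ∀ g h → coords ⟨ g , h ⟩ ≡ (g , h)
  coords-⟨⟩ = remQuot-combine

  ⟨coords⟩ : ∀ p → uncurry ⟨_,_⟩ (coords p) ≡ p
  ⟨coords⟩ = combine-remQuot {n G} (n H)

  -- Adj (G ⊠ H) p q is definitionally coords p ∼ coords q.
  _∼_ : Fin (n G) × Fin (n H) → Fin (n G) × Fin (n H) → Set
  (g , h) ∼ (g′ , h′) = (h ≡ h′ × Adj G g g′) ⊎ (g ≡ g′ × Adj H h h′) ⊎ (Adj G g g′ × Adj H h h′)

  ∼⇒Adj : ∀ {g h g′ h′} → (g , h) ∼ (g′ , h′) → Adj (G ⊠ H) ⟨ g , h ⟩ ⟨ g′ , h′ ⟩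
  ∼⇒Adj = subst₂ _∼_ (sym (coords-⟨⟩ _ _)) (sym (coords-⟨⟩ _ _))

  liftˡ : ∀ {g g′ k} → Walk G g g′ k → ∀ h → Walk (G ⊠ H) ⟨ g , h ⟩ ⟨ g′ , h ⟩ k
  liftˡ here         _ = here
  liftˡ (step a walk) h = step (∼⇒Adj (inj₁ (refl , a))) (liftˡ walk h)

  liftʳ : ∀ {h h′ k} → Walk H h h′ k → ∀ g → Walk (G ⊠ H) ⟨ g , h ⟩ ⟨ g , h′ ⟩ k
  liftʳ here         _ = here
  liftʳ (step a walk) g = step (∼⇒Adj (inj₂ (inj₁ (refl , a)))) (liftʳ walk g)

  ⊠-connected : Connected G → Connected H → Connected (G ⊠ H)
  ⊠-connected connected-G connected-H p q =
    let (g , h) = coords p ; (g′ , h′) = coords q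
        k , walk-G = connected-G g g′ ; m , walk-H = connected-H h h′
    in  k + m , subst₂ (λ s t → Walk (G ⊠ H) s t (k + m)) (⟨coords⟩ p) (⟨coords⟩ q)
                       (liftˡ walk-G h ++ʷ liftʳ walk-H g′)

  ⊠-simple : IsSimple G → IsSimple H → IsSimple (G ⊠ H)
  ⊠-simple simple-G simple-H = record { sym = symmetric ; irrefl = irreflexive }
    where
    module G = IsSimple simple-G
    module H = IsSimple simple-H

    symmetric : ∀ {x y} → x ∼ y → y ∼ x
    symmetric (inj₁ (h≡h′ , a))        = inj₁ (sym h≡h′ , G.sym a)
    symmetric (inj₂ (inj₁ (g≡g′ , b))) = inj₂ (inj₁ (sym g≡g′ , H.sym b))
    symmetric (inj₂ (inj₂ (a , b)))    = inj₂ (inj₂ (G.sym a , H.sym b))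

    irreflexive : ∀ {x} → ¬ x ∼ x
    irreflexive (inj₁ (_ , a))        = G.irrefl a
    irreflexive (inj₂ (inj₁ (_ , b))) = H.irrefl b
    irreflexive (inj₂ (inj₂ (a , _))) = G.irrefl a

  ⊠-maximalNeighbour : IsSimple H → ∀ {h h′} → MaximalNeighbour H h h′ →
                       ∀ g → MaximalNeighbour (G ⊠ H) ⟨ g , h ⟩ ⟨ g , h′ ⟩
  ⊠-maximalNeighbour simple {h} {h′} maximal g = record
    { adjacent  = ∼⇒Adj (inj₂ (inj₁ (refl , adjacent)))
    ; dominates = λ {z} a → lift z (dominated (subst (_∼ coords z) (coords-⟨⟩ g h) a))
    }
    where
    open MaximalNeighbour maximal
    open IsSimple simple using () renaming (sym to Adj-sym)

    dominated : ∀ {g₂ h₂} → (g , h) ∼ (g₂ , h₂) → (g₂ , h₂) ≡ (g , h′) ⊎ (g , h′) ∼ (g₂ , h₂)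
    dominated (inj₁ (refl , a)) = inj₂ (inj₂ (inj₂ (a , Adj-sym adjacent)))
    dominated (inj₂ (inj₁ (refl , b))) with dominates b
    ... | inj₁ refl = inj₁ refl
    ... | inj₂ b′   = inj₂ (inj₂ (inj₁ (refl , b′)))
    dominated (inj₂ (inj₂ (a , b))) with dominates b
    ... | inj₁ refl = inj₂ (inj₁ (refl , a))
    ... | inj₂ b′   = inj₂ (inj₂ (inj₂ (a , b′)))

    lift : ∀ z → coords z ≡ (g , h′) ⊎ (g , h′) ∼ coords z →
           z ≡ ⟨ g , h′ ⟩ ⊎ Adj (G ⊠ H) ⟨ g , h′ ⟩ z
    lift z (inj₁ z≡) = inj₁ (trans (sym (⟨coords⟩ z)) (cong (uncurry ⟨_,_⟩) z≡))
    lift z (inj₂ a)  = inj₂ (subst (_∼ coords z) (sym (coords-⟨⟩ g h′)) a)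

  ⊠-maximalNeighbours : IsSimple H → (∀ h → ∃ (MaximalNeighbour H h)) →
                        ∀ p → ∃ (MaximalNeighbour (G ⊠ H) p)
  ⊠-maximalNeighbours simple maximal p =
    let (g , h) = coords p ; h′ , h′-maximal = maximal h
    in  ⟨ g , h′ ⟩ , subst (λ s → MaximalNeighbour (G ⊠ H) s ⟨ g , h′ ⟩) (⟨coords⟩ p)
                           (⊠-maximalNeighbour simple h′-maximal g)

K₂-simple : IsSimple K₂
K₂-simple = record { sym = λ u≢v → u≢v ∘ sym ; irrefl = λ u≢u → u≢u refl }

K₂-connected : Connected K₂
K₂-connected u v with u ≟ v
... | yes refl = 0 , here
... | no u≢v   = 1 , step u≢v here

K₂-maximalNeighbour : ∀ {v u} → v ≢ u → MaximalNeighbour K₂ v u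
K₂-maximalNeighbour {v} {u} v≢u = record { adjacent = v≢u ; dominates = other }
  where
  other : ∀ {z} → v ≢ z → z ≡ u ⊎ u ≢ z
  other {z} _ with z ≟ u
  ... | yes z≡u = inj₁ z≡u
  ... | no z≢u  = inj₂ (z≢u ∘ sym)

K₂-maximalNeighbours : ∀ v → ∃ (MaximalNeighbour K₂ v)
K₂-maximalNeighbours zero       = suc zero , K₂-maximalNeighbour λ ()
K₂-maximalNeighbours (suc zero) = zero     , K₂-maximalNeighbour λ ()

mainTheorem3 : (G : Graph) → IsSimple G → Connected G → MDim (G ⊠ K₂) (n (G ⊠ K₂))
mainTheorem3 G simple connected =
  maximalNeighbours⇒MDim-n (G ⊠ K₂)
    (⊠-simple {G} simple K₂-simple)
    (⊠-connected {G} connected K₂-connected)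
    (⊠-maximalNeighbours {G} K₂-simple K₂-maximalNeighbours)
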